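{- Let $A=(a,\,(u+1)a+d,\,(4u+1)a+4d,\,(17u+1)a+17d)$, where $d$ is a positive integer with $\gcd(a,d)=1$, $u\ge 3$ is an integer, and $a\ge 2$. Let $p$ be a positive divisor of $a$ with $p\ne a$. Then $$F\left(\frac{\langle A\rangle}{p}\right)=\frac{a}{p}\left(\left\lfloor\frac{a-p}{17}\right\rfloor+ua+d+\varphi_2\big((a-p)\bmod 17\big)\right)-(ua+d),$$ where $(\varphi_2(i))_{0\le i\le 16}=(-1,0,1,2,0,1,2,3,1,2,3,4,2,3,4,5,3)$.
   Context: $\langle A\rangle$ is the set of non-negative integer linear combinations of the entries of $A$, and $\frac{\langle A\rangle}{p}=\{x\in\mathbb{N}\mid px\in\langle A\rangle\}$ (with $\mathbb{N}$ the non-negative integers), a numerical semigroup. $F(S)$ is the largest integer not in the numerical semigroup $S$. $(a-p)\bmod 17$ denotes the remainder in $\{0,\dots,16\}$. -}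

module Defs where

open import Data.Nat using (ℕ; zero; suc; _+_; _*_; _∸_; _<_; NonZero)
open import Data.Nat.DivMod using (_/_; _%_)
open import Data.Integer as ℤ using (ℤ; +_; -[1+_])
open import Data.List using (List; []; _∷_)
open import Data.Product using (∃; _×_; _,_)
open import Relation.Nullary using (¬_)
open import Relation.Binary.PropositionalEquality using (_≡_)

InSG : List ℕ → ℕ → Set
InSG []       x = x ≡ 0
InSG (g ∷ gs) x = ∃ λ c → ∃ λ y → InSG gs y × x ≡ c * g + y

InQuot : List ℕ → ℕ → ℕ → Set
InQuot A p x = InSG A (p * x)

-- f is the Frobenius number (largest integer not in S) of the numerical
-- semigroup S ⊆ ℕ, with the convention F(ℕ) = -1.
IsFrobenius : (ℕ → Set) → ℤ → Set
IsFrobenius S f =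
  ((n : ℕ) → f ≡ + n → ¬ S n) × ((n : ℕ) → f ℤ.< + n → S n)

genA : ℕ → ℕ → ℕ → List ℕ
genA a d u =
  a ∷ (suc u * a + d) ∷ ((4 * u + 1) * a + 4 * d) ∷ ((17 * u + 1) * a + 17 * d) ∷ []

-- φ₂(i) for 0 ≤ i ≤ 16 (value 0 beyond, never used)
φ₂ : ℕ → ℤ
φ₂ 0  = -[1+ 0 ]
φ₂ 1  = + 0
φ₂ 2  = + 1
φ₂ 3  = + 2
φ₂ 4  = + 0
φ₂ 5  = + 1
φ₂ 6  = + 2
φ₂ 7  = + 3
φ₂ 8  = + 1
φ₂ 9  = + 2
φ₂ 10 = + 3
φ₂ 11 = + 4
φ₂ 12 = + 2
φ₂ 13 = + 3
φ₂ 14 = + 4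
φ₂ 15 = + 5
φ₂ 16 = + 3
φ₂ _  = + 0

formula : (a d u p : ℕ) → .{{NonZero p}} → ℤ
formula a d u p =
  + (a / p) ℤ.* (+ ((a ∸ p) / 17) ℤ.+ + (u * a + d) ℤ.+ φ₂ ((a ∸ p) % 17))
    ℤ.- + (u * a + d)

module Submission where

-- Put s = u a + d. The generators are a, a + s, a + 4 s, a + 17 s, so ⟨A⟩ consists of
-- the M a + N s with M ≥ minParts N, the least number of parts of N from {1, 4, 17}.
-- Write a = b p with b ≥ 2 and h = minParts ((b - 1) p) - 1; as φ₂ i = minParts i - 1
-- for i < 17, the claimed value is F = (b - 1) s + b h. Since gcd(a, s) = 1, the representation
-- p F = h a + (b - 1) p s with (b - 1) p < a and h < s is the only one, and it violates
-- M ≥ minParts N. For y > F choose k < b with k s ≡ y (mod b), so y = k s + t b and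
-- p y = t a + (k p) s; as minParts drops by at most 3 per unit step,
-- minParts (k p) ≤ 3 (b - 1 - k) p + h + 1, and 3 a ≤ s then forces t ≥ minParts (k p).

open import Defs
open import Data.Empty using (⊥-elim)
open import Data.Integer as ℤ using (ℤ; +_)
import Data.Integer.Properties as ℤ
import Data.Integer.Tactic.RingSolver as ℤ-Solver
open import Data.Nat using (ℕ; zero; suc; pred; _+_; _*_; _∸_; _≤_; _<_; _≥_; _≤?_; _<?_; s≤s; z<s;
                            NonZero; >-nonZero; >-nonZero⁻¹)
open import Data.Nat.Coprimality using (Coprime; gcd≡1⇒coprime; coprime-divisor; coprime-Bézout)
open import Data.Nat.DivMod
open import Data.Nat.Divisibility using (_∣_; divides; ∣-refl; ∣-trans; ∣⇒≤; ∣m+n∣m⇒∣n; n∣m*n; m∣m*n)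
open import Data.Nat.GCD using (gcd; module Bézout)
open import Data.Nat.Properties
open import Data.Nat.Tactic.RingSolver using (solve-∀)
open import Data.Product using (∃; ∃₂; _×_; _,_)
open import Function.Base using (_∘_)
open import Function.Bundles using (_⇔_; mk⇔; Equivalence)
open import Function.Properties.Equivalence using () renaming (sym to ⇔-sym)
open import Relation.Binary using (tri<; tri≈; tri>)
open import Relation.Binary.PropositionalEquality
open import Relation.Nullary using (¬_; contradiction)
open import Relation.Nullary.Decidable using (from-yes; _→-dec_)

mod-induction : ∀ k .{{_ : NonZero k}} (P : ℕ → Set) →
                (∀ {r} → r < k → P r) → (∀ {n} → P n → P (k + n)) → ∀ n → P n
mod-induction k P base step n =
  subst P (sym (trans (m≡m%n+[m/n]*n n k) (+-comm (n % k) _))) (go (n / k))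
  where
  go : ∀ q → P (q * k + n % k)
  go zero    = base (m%n<n n k)
  go (suc q) = subst P (sym (+-assoc k (q * k) (n % k))) (step (go q))

minParts₄ : ℕ → ℕ
minParts₄ m = m / 4 + m % 4

-- The least number of parts in a partition of n into parts 1, 4 and 17:
-- the greedy count is optimal by minParts-≤-parts.
minParts : ℕ → ℕ
minParts n = n / 17 + minParts₄ (n % 17)

minParts-17+ : ∀ n → minParts (17 + n) ≡ suc (minParts n)
minParts-17+ n = cong₂ _+_ (m/n≡1+[m∸n]/n (m≤m+n 17 n)) (cong minParts₄ (%-remove-+ˡ n ∣-refl))

minParts-4+-≤ : ∀ n → minParts (4 + n) ≤ suc (minParts n)
minParts-4+-≤ = mod-induction 17 _
  (from-yes (allUpTo? (λ n → minParts (4 + n) ≤? suc (minParts n)) 17))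
  λ {n} ih → subst₂ _≤_ (sym (minParts-17+ (4 + n))) (sym (cong suc (minParts-17+ n))) (s≤s ih)

minParts-≤-3+suc : ∀ n → minParts n ≤ 3 + minParts (suc n)
minParts-≤-3+suc = mod-induction 17 _
  (from-yes (allUpTo? (λ n → minParts n ≤? 3 + minParts (suc n)) 17))
  λ {n} ih → subst₂ _≤_ (sym (minParts-17+ n))
                        (sym (trans (cong (λ m → 3 + m) (minParts-17+ (suc n))) (+-suc 3 (minParts (suc n)))))
                        (s≤s ih)

minParts-≤ : ∀ n → minParts n ≤ n
minParts-≤ = mod-induction 17 _
  (from-yes (allUpTo? (λ n → minParts n ≤? n) 17))
  λ {n} ih → subst (_≤ 17 + n) (sym (minParts-17+ n)) (s≤s (m≤n⇒m≤o+n 16 ih))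

minParts-pos : ∀ n → 0 < n → 0 < minParts n
minParts-pos = mod-induction 17 _
  (from-yes (allUpTo? (λ n → 0 <? n →-dec 0 <? minParts n) 17))
  λ {n} _ _ → subst (0 <_) (sym (minParts-17+ n)) z<s

φ₂≡minParts₄-1 : ∀ {r} → r < 17 → φ₂ r ≡ + minParts₄ r ℤ.- + 1
φ₂≡minParts₄-1 = from-yes (allUpTo? (λ r → φ₂ r ℤ.≟ + minParts₄ r ℤ.- + 1) 17)

minParts-≤-parts : ∀ c₁₇ c₄ c₁ → minParts (c₁₇ * 17 + (c₄ * 4 + c₁)) ≤ c₁₇ + (c₄ + c₁)
minParts-≤-parts (suc c₁₇) c₄ c₁ =
  subst (_≤ suc (c₁₇ + (c₄ + c₁))) (sym (minParts-17+ (c₁₇ * 17 + (c₄ * 4 + c₁))))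
        (s≤s (minParts-≤-parts c₁₇ c₄ c₁))
minParts-≤-parts zero (suc c₄) c₁ = ≤-trans (minParts-4+-≤ (c₄ * 4 + c₁)) (s≤s (minParts-≤-parts 0 c₄ c₁))
minParts-≤-parts zero zero c₁ = minParts-≤ c₁

minParts-greedy : ∀ n → (n / 17) * 17 + ((n % 17 / 4) * 4 + n % 17 % 4) ≡ n
minParts-greedy n = begin
  (n / 17) * 17 + ((n % 17 / 4) * 4 + n % 17 % 4) ≡⟨ cong (λ m → (n / 17) * 17 + m) (+-comm ((n % 17 / 4) * 4) (n % 17 % 4)) ⟩
  (n / 17) * 17 + (n % 17 % 4 + (n % 17 / 4) * 4) ≡⟨ cong (λ m → (n / 17) * 17 + m) (sym (m≡m%n+[m/n]*n (n % 17) 4)) ⟩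
  (n / 17) * 17 + n % 17                          ≡⟨ +-comm _ (n % 17) ⟩
  n % 17 + (n / 17) * 17                          ≡⟨ sym (m≡m%n+[m/n]*n n 17) ⟩
  n ∎
  where open ≡-Reasoning

minParts-≤-3*+ : ∀ m j → minParts m ≤ 3 * j + minParts (m + j)
minParts-≤-3*+ m zero    = ≤-reflexive (cong minParts (sym (+-identityʳ m)))
minParts-≤-3*+ m (suc j) = begin
  minParts m                           ≤⟨ minParts-≤-3+suc m ⟩
  3 + minParts (suc m)                 ≤⟨ +-monoʳ-≤ 3 (minParts-≤-3*+ (suc m) j) ⟩
  3 + (3 * j + minParts (suc m + j))   ≡⟨ sym (+-assoc 3 (3 * j) _) ⟩
  3 + 3 * j + minParts (suc m + j)     ≡⟨ cong₂ _+_ (sym (*-suc 3 j)) (cong minParts (sym (+-suc m j))) ⟩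
  3 * suc j + minParts (m + suc j)     ∎
  where open ≤-Reasoning

Expressible : ℕ → ℕ → ℕ → Set
Expressible a s x = ∃₂ λ M N → minParts N ≤ M × x ≡ M * a + N * s

genA-combination : ∀ a d u c₀ c₁ c₄ c₁₇ →
  c₀ * a + (c₁ * (suc u * a + d) + (c₄ * ((4 * u + 1) * a + 4 * d)
           + (c₁₇ * ((17 * u + 1) * a + 17 * d) + 0)))
    ≡ (c₀ + (c₁₇ + (c₄ + c₁))) * a + (c₁₇ * 17 + (c₄ * 4 + c₁)) * (u * a + d)
genA-combination = solve-∀

InSG-genA⇔Expressible : ∀ a d u x → InSG (genA a d u) x ⇔ Expressible a (u * a + d) x
InSG-genA⇔Expressible a d u x = mk⇔ to from
  where
  s : ℕ
  s = u * a + d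

  to : InSG (genA a d u) x → Expressible a s x
  to (c₀ , _ , (c₁ , _ , (c₄ , _ , (c₁₇ , _ , refl , refl) , refl) , refl) , x≡) =
    c₀ + (c₁₇ + (c₄ + c₁)) , c₁₇ * 17 + (c₄ * 4 + c₁) ,
    ≤-trans (minParts-≤-parts c₁₇ c₄ c₁) (m≤n+m _ c₀) ,
    trans x≡ (genA-combination a d u c₀ c₁ c₄ c₁₇)

  from : Expressible a s x → InSG (genA a d u) x
  from (M , N , minParts≤M , refl) =
    M ∸ minParts N , _ , (c₁ , _ , (c₄ , _ , (c₁₇ , 0 , refl , refl) , refl) , refl) ,
    trans (cong₂ (λ M N → M * a + N * s) (sym (m∸n+n≡m minParts≤M)) (sym (minParts-greedy N)))
          (sym (genA-combination a d u (M ∸ minParts N) c₁ c₄ c₁₇))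
    where
    c₁₇ c₄ c₁ : ℕ
    c₁₇ = N / 17
    c₄  = N % 17 / 4
    c₁  = N % 17 % 4

coprime-+* : ∀ {m n} k → Coprime m n → Coprime m (k * m + n)
coprime-+* k cop (i∣m , i∣km+n) = cop (i∣m , ∣m+n∣m⇒∣n i∣km+n (∣-trans i∣m (n∣m*n k)))

coprime-∣ˡ : ∀ {d m n} → d ∣ m → Coprime m n → Coprime d n
coprime-∣ˡ d∣m cop (i∣d , i∣n) = cop (∣-trans i∣d d∣m , i∣n)

%-cong-*ʳ : ∀ m n o d .{{_ : NonZero d}} → m % d ≡ n % d → (m * o) % d ≡ (n * o) % d
%-cong-*ʳ m n o d eq = begin
  (m * o) % d               ≡⟨ %-distribˡ-* m o d ⟩
  (m % d * (o % d)) % d     ≡⟨ cong (λ r → (r * (o % d)) % d) eq ⟩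
  (n % d * (o % d)) % d     ≡⟨ sym (%-distribˡ-* n o d) ⟩
  (n * o) % d               ∎
  where open ≡-Reasoning

coprime⇒∃-inverse : ∀ {m s} → Coprime (suc m) s → ∃ λ w → (w * s) % suc m ≡ 1 % suc m
coprime⇒∃-inverse {m} {s} cop with coprime-Bézout cop
... | Bézout.-+ x y 1+x[1+m]≡ys = y , (begin
  (y * s) % suc m           ≡⟨ cong (_% suc m) (sym 1+x[1+m]≡ys) ⟩
  (1 + x * suc m) % suc m   ≡⟨ [m+kn]%n≡m%n 1 x (suc m) ⟩
  1 % suc m                 ∎)
  where open ≡-Reasoning
... | Bézout.+- x y 1+ys≡x[1+m] = y * m , (begin
  (y * m * s) % suc m                     ≡⟨ sym ([m+kn]%n≡m%n (y * m * s) 1 (suc m)) ⟩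
  (y * m * s + 1 * suc m) % suc m         ≡⟨ cong (_% suc m) (shift y m s x) ⟩
  (m * (1 + y * s) + 1) % suc m           ≡⟨ cong (λ z → (m * z + 1) % suc m) 1+ys≡x[1+m] ⟩
  (m * (x * suc m) + 1) % suc m           ≡⟨ cong (_% suc m) (regroup m x) ⟩
  (1 + (m * x) * suc m) % suc m           ≡⟨ [m+kn]%n≡m%n 1 (m * x) (suc m) ⟩
  1 % suc m                               ∎)
  where
  open ≡-Reasoning
  shift : ∀ y m s x → y * m * s + 1 * suc m ≡ m * (1 + y * s) + 1
  shift = solve-∀
  regroup : ∀ m x → m * (x * suc m) + 1 ≡ 1 + (m * x) * suc m
  regroup = solve-∀

coprime⇒∃-residue : ∀ {m s} → Coprime (suc m) s → ∀ y → ∃ λ k → k < suc m × (k * s) % suc m ≡ y % suc m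
coprime⇒∃-residue {m} {s} cop y with coprime⇒∃-inverse cop
... | w , ws≡1 = (y * w) % suc m , m%n<n (y * w) (suc m) , (begin
  ((y * w) % suc m * s) % suc m   ≡⟨ %-cong-*ʳ ((y * w) % suc m) (y * w) s (suc m) (m%n%n≡m%n (y * w) (suc m)) ⟩
  (y * w * s) % suc m             ≡⟨ cong (_% suc m) (*-assoc y w s) ⟩
  (y * (w * s)) % suc m           ≡⟨ cong (_% suc m) (*-comm y (w * s)) ⟩
  (w * s * y) % suc m             ≡⟨ %-cong-*ʳ (w * s) 1 y (suc m) ws≡1 ⟩
  (1 * y) % suc m                 ≡⟨ cong (_% suc m) (*-identityˡ y) ⟩
  y % suc m                       ∎)
  where open ≡-Reasoning

≤∧%≡%⇒∃[t]n≡m+t*k : ∀ {m n} k .{{_ : NonZero k}} → m ≤ n → m % k ≡ n % k → ∃ λ t → n ≡ m + t * k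
≤∧%≡%⇒∃[t]n≡m+t*k {m} {n} k m≤n m%k≡n%k = n / k ∸ m / k , (begin
  n                                        ≡⟨ m≡m%n+[m/n]*n n k ⟩
  n % k + n / k * k                        ≡⟨ cong₂ (λ r q → r + q * k) (sym m%k≡n%k) (sym (m+[n∸m]≡n (/-mono-≤ m≤n ≤-refl))) ⟩
  m % k + (m / k + (n / k ∸ m / k)) * k    ≡⟨ regroup (m % k) (m / k) (n / k ∸ m / k) k ⟩
  (m % k + m / k * k) + (n / k ∸ m / k) * k ≡⟨ cong (_+ (n / k ∸ m / k) * k) (sym (m≡m%n+[m/n]*n m k)) ⟩
  m + (n / k ∸ m / k) * k                  ∎)
  where
  open ≡-Reasoning
  regroup : ∀ r q t k → r + (q + t) * k ≡ (r + q * k) + t * k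
  regroup = solve-∀

coprime-*+*⇒≤ : ∀ {a s e} x y → Coprime a s → x * a ≡ y * a + suc e * s → a ≤ suc e
coprime-*+*⇒≤ {a} {s} {e} x y cop eq =
  ∣⇒≤ (coprime-divisor cop (subst (a ∣_) (*-comm (suc e) s)
        (∣m+n∣m⇒∣n (subst (a ∣_) eq (n∣m*n x)) (n∣m*n y))))

representation-≢-larger : ∀ {a s n h N M} .{{_ : NonZero a}} → Coprime a s → h < s → n < N →
                          h * a + n * s ≢ M * a + N * s
representation-≢-larger {a} {s} {n} {h} {N} {M} cop h<s n<N eq with m≤n⇒∃[o]m+o≡n n<N
... | o , refl = <-irrefl refl (begin-strict
  s * a             ≤⟨ *-monoʳ-≤ s (coprime-*+*⇒≤ h M cop ha≡) ⟩
  s * suc o         ≡⟨ *-comm s (suc o) ⟩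
  suc o * s         ≤⟨ m≤n+m (suc o * s) (M * a) ⟩
  M * a + suc o * s ≡⟨ sym ha≡ ⟩
  h * a             <⟨ *-monoˡ-< a h<s ⟩
  s * a             ∎)
  where
  open ≤-Reasoning
  regroup : ∀ M a n o s → M * a + (suc n + o) * s ≡ M * a + suc o * s + n * s
  regroup = solve-∀
  ha≡ : h * a ≡ M * a + suc o * s
  ha≡ = +-cancelʳ-≡ (n * s) _ _ (trans eq (regroup M a n o s))

representation-≢-smaller : ∀ {a s n h N M} → Coprime a s → n < a → N < n →
                           h * a + n * s ≢ M * a + N * s
representation-≢-smaller {a} {s} {n} {h} {N} {M} cop n<a N<n eq with m≤n⇒∃[o]m+o≡n N<n
... | o , refl = <-irrefl refl (begin-strict
  a          ≤⟨ coprime-*+*⇒≤ M h cop Ma≡ ⟩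
  suc o      ≤⟨ s≤s (m≤n+m o N) ⟩
  suc N + o  <⟨ n<a ⟩
  a          ∎)
  where
  open ≤-Reasoning
  regroup : ∀ h a N o s → h * a + (suc N + o) * s ≡ h * a + suc o * s + N * s
  regroup = solve-∀
  Ma≡ : M * a ≡ h * a + suc o * s
  Ma≡ = sym (+-cancelʳ-≡ (N * s) _ _ (trans (sym (regroup h a N o s)) eq))

coprime⇒unique-representation : ∀ {a s n h N M} → Coprime a s → n < a → h < s →
                                h * a + n * s ≡ M * a + N * s → n ≡ N × h ≡ M
coprime⇒unique-representation {a} {s} {n} {h} {N} {M} cop n<a h<s eq with <-cmp n N
... | tri< n<N _ _ = ⊥-elim (representation-≢-larger {h = h} {M = M} {{>-nonZero (m<n⇒0<n n<a)}} cop h<s n<N eq)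
... | tri> _ _ N<n = ⊥-elim (representation-≢-smaller {h = h} {M = M} cop n<a N<n eq)
... | tri≈ _ refl _ =
  refl , *-cancelʳ-≡ h M a {{>-nonZero (m<n⇒0<n n<a)}} (+-cancelʳ-≡ (n * s) _ _ eq)

¬Expressible-gap : ∀ {a s n h} → Coprime a s → n < a → minParts n ≡ suc h → h < s →
                   ¬ Expressible a s (h * a + n * s)
¬Expressible-gap cop n<a minParts≡ h<s (M , N , minPartsN≤M , eq)
  with coprime⇒unique-representation {N = N} {M = M} cop n<a h<s eq
... | refl , refl = <-irrefl refl (subst (_≤ M) minParts≡ minPartsN≤M)

below-minParts⇒≤ : ∀ {b p s h k t} → k ≤ b → 3 * (suc b * p) ≤ s → minParts (b * p) ≡ suc h →
                   t < minParts (k * p) → k * s + t * suc b ≤ b * s + suc b * h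
below-minParts⇒≤ {b} {p} {s} {h} {k} {t} k≤b 3a≤s minParts≡ t<minParts = begin
  k * s + t * suc b                      ≤⟨ +-monoʳ-≤ (k * s) (*-monoˡ-≤ (suc b) t≤) ⟩
  k * s + (3 * (j * p) + h) * suc b      ≡⟨ regroup k s j p h b ⟩
  k * s + j * (3 * (suc b * p)) + suc b * h
    ≤⟨ +-monoˡ-≤ (suc b * h) (+-monoʳ-≤ (k * s) (*-monoʳ-≤ j 3a≤s)) ⟩
  k * s + j * s + suc b * h
    ≡⟨ cong (_+ suc b * h) (trans (sym (*-distribʳ-+ s k j)) (cong (_* s) k+j≡b)) ⟩
  b * s + suc b * h                      ∎
  where
  open ≤-Reasoning
  j : ℕ
  j = b ∸ k
  k+j≡b : k + j ≡ b
  k+j≡b = m+[n∸m]≡n k≤b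
  t≤ : t ≤ 3 * (j * p) + h
  t≤ = ≤-pred (begin
    suc t                          ≤⟨ t<minParts ⟩
    minParts (k * p)               ≤⟨ minParts-≤-3*+ (k * p) (j * p) ⟩
    3 * (j * p) + minParts (k * p + j * p)
      ≡⟨ cong (λ m → 3 * (j * p) + minParts m) (trans (sym (*-distribʳ-+ p k j)) (cong (_* p) k+j≡b)) ⟩
    3 * (j * p) + minParts (b * p) ≡⟨ cong (λ m → 3 * (j * p) + m) minParts≡ ⟩
    3 * (j * p) + suc h            ≡⟨ +-suc (3 * (j * p)) h ⟩
    suc (3 * (j * p) + h)          ∎)
  regroup : ∀ k s j p h b →
            k * s + (3 * (j * p) + h) * suc b ≡ k * s + j * (3 * (suc b * p)) + suc b * h
  regroup = solve-∀

Expressible-above : ∀ b p {s h} → Coprime (suc b) s → 3 * (suc b * p) ≤ s →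
                    minParts (b * p) ≡ suc h → ∀ y → b * s + suc b * h < y → Expressible (suc b * p) s (p * y)
Expressible-above b p {s} {h} cop 3a≤s minParts≡ y F<y with coprime⇒∃-residue cop y
... | k , k<1+b , ks≡y[mod] with ≤∧%≡%⇒∃[t]n≡m+t*k (suc b) ks≤y ks≡y[mod]
  where
  ks≤y : k * s ≤ y
  ks≤y = ≤-trans (*-monoˡ-≤ s (≤-pred k<1+b)) (≤-trans (m≤m+n (b * s) (suc b * h)) (<⇒≤ F<y))
...   | t , y≡ = t , k * p , minParts≤t , trans (cong (λ m → p * m) y≡) (regroup p k s t b)
  where
  minParts≤t : minParts (k * p) ≤ t
  minParts≤t = ≮⇒≥ λ t<minParts → <⇒≱ F<y
    (subst (_≤ b * s + suc b * h) (sym y≡) (below-minParts⇒≤ (≤-pred k<1+b) 3a≤s minParts≡ t<minParts))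
  regroup : ∀ p k s t b → p * (k * s + t * suc b) ≡ t * (suc b * p) + (k * p) * s
  regroup = solve-∀

frobenius-Expressible : ∀ b p {s h} .{{_ : NonZero p}} → Coprime (suc b * p) s →
                        3 * (suc b * p) ≤ s → minParts (b * p) ≡ suc h →
                        IsFrobenius (λ x → Expressible (suc b * p) s (p * x)) (+ (b * s + suc b * h))
frobenius-Expressible b p {s} {h} cop 3a≤s minParts≡ = gap , above
  where
  a : ℕ
  a = suc b * p
  bp<a : b * p < a
  bp<a = m<n+m (b * p) (>-nonZero⁻¹ p)
  h<s : h < s
  h<s = begin-strict
    h                <⟨ n<1+n h ⟩
    suc h            ≡⟨ sym minParts≡ ⟩
    minParts (b * p) ≤⟨ minParts-≤ (b * p) ⟩
    b * p            <⟨ bp<a ⟩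
    a                ≤⟨ m≤m+n a (2 * a) ⟩
    3 * a            ≤⟨ 3a≤s ⟩
    s                ∎
    where open ≤-Reasoning
  gap : ∀ n → + (b * s + suc b * h) ≡ + n → ¬ Expressible a s (p * n)
  gap n refl =
    subst (¬_ ∘ Expressible a s) (regroup p b s h) (¬Expressible-gap cop bp<a minParts≡ h<s)
    where
    regroup : ∀ p b s h → h * (suc b * p) + b * p * s ≡ p * (b * s + suc b * h)
    regroup = solve-∀
  above : ∀ n → + (b * s + suc b * h) ℤ.< + n → Expressible a s (p * n)
  above n F<n =
    Expressible-above b p (coprime-∣ˡ (m∣m*n p) cop) 3a≤s minParts≡ n (ℤ.drop‿+<+ F<n)

formula≡ : ∀ b d u p h .{{_ : NonZero p}} → minParts (b * p) ≡ suc h →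
           formula (suc b * p) d u p ≡ + (b * (u * (suc b * p) + d) + suc b * h)
formula≡ b d u p h minParts≡ = begin
  formula (suc b * p) d u p
    ≡⟨ cong₂ (λ B n → + B ℤ.* (+ (n / 17) ℤ.+ + s ℤ.+ φ₂ (n % 17)) ℤ.- + s)
             (m*n/n≡m (suc b) p) (m+n∸m≡n p (b * p)) ⟩
  + suc b ℤ.* (+ q ℤ.+ + s ℤ.+ φ₂ r) ℤ.- + s
    ≡⟨ cong (λ z → + suc b ℤ.* (+ q ℤ.+ + s ℤ.+ z) ℤ.- + s) (φ₂≡minParts₄-1 (m%n<n (b * p) 17)) ⟩
  + suc b ℤ.* (+ q ℤ.+ + s ℤ.+ (+ minParts₄ r ℤ.- + 1)) ℤ.- + s
    ≡⟨ regroup (+ b) (+ q) (+ s) (+ minParts₄ r) ⟩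
  + b ℤ.* + s ℤ.+ + suc b ℤ.* (+ minParts (b * p) ℤ.- + 1)
    ≡⟨ cong (λ m → + b ℤ.* + s ℤ.+ + suc b ℤ.* (+ m ℤ.- + 1)) minParts≡ ⟩
  + b ℤ.* + s ℤ.+ + suc b ℤ.* + h
    ≡⟨ sym (cong₂ ℤ._+_ (ℤ.pos-* b s) (ℤ.pos-* (suc b) h)) ⟩
  + (b * s + suc b * h) ∎
  where
  open ≡-Reasoning
  s q r : ℕ
  s = u * (suc b * p) + d
  q = b * p / 17
  r = b * p % 17
  regroup : ∀ (B Q S R : ℤ) → (ℤ.1ℤ ℤ.+ B) ℤ.* (Q ℤ.+ S ℤ.+ (R ℤ.- ℤ.1ℤ)) ℤ.- S
                      ≡ B ℤ.* S ℤ.+ (ℤ.1ℤ ℤ.+ B) ℤ.* (Q ℤ.+ R ℤ.- ℤ.1ℤ)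
  regroup = ℤ-Solver.solve-∀

IsFrobenius-cong : ∀ {S T : ℕ → Set} {f g} → (∀ n → S n ⇔ T n) → f ≡ g →
                   IsFrobenius S f → IsFrobenius T g
IsFrobenius-cong S⇔T refl (gap , above) =
  (λ n f≡n Tn → gap n f≡n (Equivalence.from (S⇔T n) Tn)) ,
  (λ n f<n → Equivalence.to (S⇔T n) (above n f<n))

proposition4p3 : (a d u p : ℕ) → .{{_ : NonZero p}} → 1 ≤ d → gcd a d ≡ 1 → u ≥ 3 → a ≥ 2
    → p ∣ a → p ≢ a
    → IsFrobenius (InQuot (genA a d u) p) (formula a d u p)
proposition4p3 .(0 * p) d u p _ _ _ () (divides zero refl) _
proposition4p3 .(1 * p) d u p _ _ _ _ (divides 1 refl) p≢a = contradiction (sym (*-identityˡ p)) p≢a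
proposition4p3 .(suc b * p) d u p _ gcd≡1 u≥3 _ (divides (suc b@(suc b₀)) refl) _ =
  IsFrobenius-cong (λ x → ⇔-sym (InSG-genA⇔Expressible a d u (p * x)))
                   (sym (formula≡ b d u p h minParts≡))
                   (frobenius-Expressible b p (coprime-+* u (gcd≡1⇒coprime gcd≡1)) 3a≤s minParts≡)
  where
  a h : ℕ
  a = suc b * p
  instance
    minParts[bp]≢0 : NonZero (minParts (b * p))
    minParts[bp]≢0 = >-nonZero (minParts-pos (b * p) (≤-trans (>-nonZero⁻¹ p) (m≤m+n p (b₀ * p))))
  h = pred (minParts (b * p))
  minParts≡ : minParts (b * p) ≡ suc h
  minParts≡ = sym (suc-pred (minParts (b * p)))
  3a≤s : 3 * a ≤ u * a + d
  3a≤s = ≤-trans (*-monoˡ-≤ a u≥3) (m≤m+n (u * a) d)
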